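{- Let $b=p_1\cdots p_s$ be a product of $s\ge2$ distinct primes. Then for every positive integer $k$, $$\vartheta(b)b^k-Z_b(b^k)\le k(s-1).$$ As a consequence, $\eta(b,k)\le\lfloor\log_b k+\log_b(s-1)+1\rfloor\le\lfloor\log_b k+1.21\rfloor$.
   Context: $Z_b(m)$ is the number of trailing zeroes in the base-$b$ expansion of $m!$, i.e. the largest $e\ge0$ with $b^e\mid m!$. $\vartheta(b):=\lim_{m\to\infty}Z_b(m)/m$, which for squarefree $b$ equals $\frac{1}{p-1}$ where $p$ is the largest prime factor of $b$. Let $\alpha(b,k):=\lfloor\vartheta(b)b^k\rfloor-Z_b(b^k)$ (a nonnegative integer) and let $\eta(b,k)$ be the number of base-$b$ digits of $\alpha(b,k)$, i.e. $\eta(b,k)=\lfloor\log_b\alpha(b,k)+1\rfloor$ if $\alpha(b,k)\ge1$ and $\eta(b,k)=0$ if $\alpha(b,k)=0$. -}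

module Defs where

open import Data.Nat using (ℕ; zero; suc; _+_; _*_; _∸_; _^_; _<_; _<?_)
open import Data.Nat.Divisibility using (_∣_; _∣?_)
open import Data.Nat.Primality using (Prime; prime?)
open import Data.Nat using (_!)
open import Data.Integer using (ℤ; +_; -[1+_])
open import Data.Rational using (ℚ; _/_; floor; 0ℚ) renaming (_*_ to _*ℚ_)
open import Relation.Nullary using (Dec; yes; no)
open import Relation.Nullary.Decidable using () renaming (⌊_⌋ to isYes)
open import Data.Bool using (Bool; true; false; if_then_else_; _∧_)

ℕtoℚ : ℕ → ℚ
ℕtoℚ n = + n / 1

maxSat : (ℕ → Bool) → ℕ → ℕ
maxSat P zero = 0
maxSat P (suc n) = if P (suc n) then suc n else maxSat P n

-- least i ≤ n satisfying a decidable predicate (n if none)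
minSatFrom : (ℕ → Bool) → ℕ → ℕ → ℕ
minSatFrom P i zero = i
minSatFrom P i (suc fuel) = if P i then i else minSatFrom P (suc i) fuel

minSat : (ℕ → Bool) → ℕ → ℕ
minSat P n = minSatFrom P 0 n

-- largest prime factor of b (0 if b has no prime factor ≤ b, e.g. b = 0? / b = 1)
largestPrimeFactor : ℕ → ℕ
largestPrimeFactor b = maxSat (λ d → isYes (prime? d) ∧ isYes (d ∣? b)) b

-- ϑ(b) = 1/(p-1), p the largest prime factor of b (valid formula for squarefree b)
ϑ : ℕ → ℚ
ϑ b with largestPrimeFactor b
... | suc (suc q) = + 1 / suc q
... | _ = 0ℚ

-- Z b m : largest e with b^e ∣ m!  (for b ≥ 2 such e satisfy e < b^e ≤ m!, so the
-- search bound m! is harmless)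
Z : ℕ → ℕ → ℕ
Z b m = maxSat (λ e → isYes ((b ^ e) ∣? (m !))) (m !)

α : ℕ → ℕ → ℤ
α b k = floor (ϑ b *ℚ ℕtoℚ (b ^ k)) Data.Integer.- + Z b (b ^ k)

-- number of base-b digits of n: least d with n < b^d  (0 for n = 0);
-- equals ⌊log_b n + 1⌋ for n ≥ 1, b ≥ 2 (and n < b^n bounds the search)
digits : ℕ → ℕ → ℕ
digits b n = minSat (λ d → isYes (n <? b ^ d)) n

η : ℕ → ℕ → ℕ
η b k with α b k
... | + n = digits b n
... | -[1+ _ ] = 0

-- Let p be the largest of the s primes, so that m = b/p < p^(s-1) and b^k = p^k·m^k. The Legendre sum
-- L = ∑ᵢ ⌊b^k/pⁱ⌋ satisfies (p-1)·L = b^k - (base-p digit sum of b^k); since m^k has at most (s-1)k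
-- base-p digits and the factor p^k only appends zeros, b^k ≤ (p-1)(L + k(s-1)). For every prime
-- q ∣ b the same sum in base q ≤ p is at least L, so q^L ∣ (b^k)!; hence b^L ∣ (b^k)! and
-- L ≤ Z_b(b^k). Dividing by p-1 = 1/ϑ(b) gives the inequality, which also bounds α(b,k) and
-- hence η(b,k). The last bound, read as log_b(s-1) ≤ 0.21, is (s-1)^100 ≤ b^21: b is at least
-- 2·3·5·7·8·9⋯ (s factors), which outgrows (s-1)^(100/21).

module Submission where

open import Defs
open import Data.Nat using (ℕ; _*_; _∸_; _^_; _≤_)
open import Data.Nat.Primality using (Prime)
open import Data.List using (List; length)
open import Data.Nat.ListAction using (product)
open import Data.List.Relation.Unary.All using (All)
open import Data.List.Relation.Unary.Unique.Propositional using (Unique)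
open import Data.Product using (_×_)
open import Relation.Binary.PropositionalEquality using (_≡_)
import Data.Rational as ℚ

open import Data.Bool using (Bool; true; false; T; _∧_)
open import Data.Bool.Properties using (T-∧)
open import Data.Empty using (⊥-elim)
import Data.Integer as ℤ
open import Data.Integer using (+_)
import Data.Integer.DivMod as ℤ
import Data.Integer.Properties as ℤP
open import Data.Integer.Tactic.RingSolver using () renaming (solve-∀ to ℤ-solve-∀)
open import Data.List using (_∷_; [])
open import Data.List.Membership.Propositional using (_∈_)
open import Data.List.Relation.Binary.Permutation.Propositional using (↭-sym; ↭⇒↭ₛ)
open import Data.List.Relation.Binary.Permutation.Propositional.Properties using (All-resp-↭; ↭-length)
open import Data.List.Relation.Binary.Permutation.Setoid.Properties using (Unique-resp-↭)
open import Data.List.Relation.Unary.All as All using ([]; _∷_)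
open import Data.List.Relation.Unary.AllPairs as AllPairs using (AllPairs; []; _∷_)
open import Data.List.Relation.Unary.Any using (Any; here; there)
open import Data.List.Relation.Unary.Linked.Properties using (Linked⇒AllPairs)
open import Data.Nat
open import Data.Nat.Properties
import Data.Nat.Coprimality as Coprime
open import Data.Nat.DivMod
open import Data.Nat.Divisibility
open import Data.Nat.ListAction.Properties using (product-↭; ∈⇒∣product)
open import Data.Nat.Primality
open import Data.Nat.Tactic.RingSolver using (solve-∀)
open import Data.List.Sort ≤-decTotalOrder using (sort; sort-↭; sort-↗)
open import Data.Product as Product using (_,_; uncurry; proj₁; proj₂)
open import Data.Rational using (mkℚ)
import Data.Rational.Properties as ℚP
open import Data.Rational.Solver using () renaming (module +-*-Solver to ℚ-Solver)
open import Data.Rational.Unnormalised using (mkℚᵘ; *≡*; *≤*)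
import Data.Rational.Unnormalised as ℚᵘ
import Data.Rational.Unnormalised.Properties as ℚᵘ
open import Data.Sum using (_⊎_; inj₁; inj₂)
open import Function using (_∘_)
open import Function.Bundles using (Equivalence)
open import Relation.Binary.PropositionalEquality
open import Relation.Nullary using (¬_; contradiction; yes; no)
open import Relation.Nullary.Decidable using (isYes; toWitness; fromWitness)

-- Bounded search and base-b digits

maxSat-≥ : ∀ P {x} n → T (P x) → x ≤ n → x ≤ maxSat P n
maxSat-≥ P zero    Px x≤0 = x≤0
maxSat-≥ P (suc n) Px x≤1+n with P (suc n) in eq | m≤n⇒m<n∨m≡n x≤1+n
... | true  | _          = x≤1+n
... | false | inj₁ x<1+n = maxSat-≥ P n Px (s≤s⁻¹ x<1+n)
... | false | inj₂ refl  = ⊥-elim (subst T eq Px)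

maxSat≡0⊎sat : ∀ P n → maxSat P n ≡ 0 ⊎ T (P (maxSat P n))
maxSat≡0⊎sat P zero = inj₁ refl
maxSat≡0⊎sat P (suc n) with P (suc n) in eq
... | true  = inj₂ (subst T (sym eq) _)
... | false = maxSat≡0⊎sat P n

minSatFrom-≤ : ∀ P {i j} f → i ≤ j → T (P j) → minSatFrom P i f ≤ j
minSatFrom-≤ P zero i≤j Pj = i≤j
minSatFrom-≤ P {i} (suc f) i≤j Pj with P i in eq | m≤n⇒m<n∨m≡n i≤j
... | true  | _        = i≤j
... | false | inj₁ i<j = minSatFrom-≤ P f i<j Pj
... | false | inj₂ refl = ⊥-elim (subst T eq Pj)

minSatFrom-sat : ∀ P {i j} f → i ≤ j → j ≤ i + f → T (P j) → T (P (minSatFrom P i f))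
minSatFrom-sat P {i} zero i≤j j≤i+0 Pj =
  subst (T ∘ P) (≤-antisym (subst (_ ≤_) (+-identityʳ i) j≤i+0) i≤j) Pj
minSatFrom-sat P {i} {j} (suc f) i≤j j≤ Pj with P i in eq | m≤n⇒m<n∨m≡n i≤j
... | true  | _         = subst T (sym eq) _
... | false | inj₁ i<j  = minSatFrom-sat P f i<j (subst (j ≤_) (+-suc i f) j≤) Pj
... | false | inj₂ refl = ⊥-elim (subst T eq Pj)

minSatFrom-minimal : ∀ P {i j} f → i ≤ j → j < minSatFrom P i f → ¬ T (P j)
minSatFrom-minimal P zero i≤j j<i = contradiction i≤j (<⇒≱ j<i)
minSatFrom-minimal P {i} (suc f) i≤j j< with P i in eq | m≤n⇒m<n∨m≡n i≤j
... | true  | _         = contradiction i≤j (<⇒≱ j<)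
... | false | inj₁ i<j  = minSatFrom-minimal P f i<j j<
... | false | inj₂ refl = subst T eq

n<m^n : ∀ {m} n → 2 ≤ m → n < m ^ n
n<m^n zero    _   = s≤s z≤n
n<m^n {m} (suc n) 2≤m = begin-strict
  suc n         ≤⟨ n<m^n n 2≤m ⟩
  m ^ n         <⟨ m<m+n (m ^ n) (≤-<-trans z≤n (n<m^n n 2≤m)) ⟩
  m ^ n + m ^ n ≡⟨ cong (_+_ (m ^ n)) (sym (+-identityʳ (m ^ n))) ⟩
  2 * m ^ n     ≤⟨ *-monoˡ-≤ (m ^ n) 2≤m ⟩
  m * m ^ n     ∎
  where open ≤-Reasoning

module _ {b : ℕ} (2≤b : 2 ≤ b) where

  private
    below : ℕ → ℕ → Bool
    below n d = isYes (n <? b ^ d)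

  n<b^digits : ∀ n → n < b ^ digits b n
  n<b^digits n = toWitness (minSatFrom-sat (below n) n z≤n ≤-refl (fromWitness (n<m^n n 2≤b)))

  digits-≤ : ∀ {n d} → n < b ^ d → digits b n ≤ d
  digits-≤ {n} n<b^d = minSatFrom-≤ (below n) n z≤n (fromWitness n<b^d)

  b^digits≤b*n : ∀ {n} → 1 ≤ n → b ^ digits b n ≤ b * n
  b^digits≤b*n {n} 1≤n with digits b n in eq
  ... | zero  = contradiction (subst (λ d → n < b ^ d) eq (n<b^digits n)) (≤⇒≯ 1≤n)
  ... | suc d = *-monoʳ-≤ b (≮⇒≥ (minSatFrom-minimal (below n) n z≤n d<digits ∘ fromWitness))
    where d<digits = subst (d <_) (sym eq) ≤-refl

b^e∣m!⇒e≤Z : ∀ {b e} m → 2 ≤ b → b ^ e ∣ m ! → e ≤ Z b m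
b^e∣m!⇒e≤Z {b} {e} m 2≤b b^e∣m! =
  maxSat-≥ (λ e → isYes (b ^ e ∣? m !)) (m !) (fromWitness b^e∣m!)
    (≤-trans (<⇒≤ (n<m^n e 2≤b)) (∣⇒≤ {{m !≢0}} b^e∣m!))

-- Powers and divisibility

[m*n]^o≡m^o*n^o : ∀ m n o → (m * n) ^ o ≡ m ^ o * n ^ o
[m*n]^o≡m^o*n^o m n zero    = refl
[m*n]^o≡m^o*n^o m n (suc o) = begin
  m * n * (m * n) ^ o     ≡⟨ cong (m * n *_) ([m*n]^o≡m^o*n^o m n o) ⟩
  m * n * (m ^ o * n ^ o) ≡⟨ regroup m n (m ^ o) (n ^ o) ⟩
  m * m ^ o * (n * n ^ o) ∎
  where
  open ≡-Reasoning
  regroup : ∀ m n x y → m * n * (x * y) ≡ m * x * (n * y)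
  regroup = solve-∀

m^i∣m^j : ∀ m {i j} → i ≤ j → m ^ i ∣ m ^ j
m^i∣m^j m {i} {j} i≤j = divides (m ^ (j ∸ i)) (begin
  m ^ j               ≡⟨ cong (m ^_) (m+[n∸m]≡n i≤j) ⟨
  m ^ (i + (j ∸ i))   ≡⟨ ^-distribˡ-+-* m i (j ∸ i) ⟩
  m ^ i * m ^ (j ∸ i) ≡⟨ *-comm (m ^ i) (m ^ (j ∸ i)) ⟩
  m ^ (j ∸ i) * m ^ i ∎)
  where open ≡-Reasoning

prime≥2 : ∀ {p} → Prime p → 2 ≤ p
prime≥2 {p} pp = nonTrivial⇒n>1 p {{prime⇒nonTrivial pp}}

prime∣prime⇒≡ : ∀ {p q} → Prime p → Prime q → p ∣ q → p ≡ q
prime∣prime⇒≡ pp pq p∣q with prime⇒irreducible pq p∣q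
... | inj₁ p≡1 = contradiction p≡1 (nonTrivial⇒≢1 {{prime⇒nonTrivial pp}})
... | inj₂ p≡q = p≡q

prime∣product⇒∈ : ∀ {p} ps → Prime p → All Prime ps → p ∣ product ps → p ∈ ps
prime∣product⇒∈ []       pp []         p∣1 = contradiction (∣1⇒≡1 p∣1) (nonTrivial⇒≢1 {{prime⇒nonTrivial pp}})
prime∣product⇒∈ (q ∷ ps) pp (pq ∷ pps) p∣qP with euclidsLemma q (product ps) pp p∣qP
... | inj₁ p∣q = here (prime∣prime⇒≡ pp pq p∣q)
... | inj₂ p∣P = there (prime∣product⇒∈ ps pp pps p∣P)

prime∤m⇒prime∤m^e : ∀ {p m} e → Prime p → ¬ p ∣ m → ¬ p ∣ m ^ e
prime∤m⇒prime∤m^e zero pp p∤m p∣1 = nonTrivial⇒≢1 {{prime⇒nonTrivial pp}} (∣1⇒≡1 p∣1)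
prime∤m⇒prime∤m^e {m = m} (suc e) pp p∤m p∣m^e+1 with euclidsLemma m (m ^ e) pp p∣m^e+1
... | inj₁ p∣m   = p∤m p∣m
... | inj₂ p∣m^e = prime∤m⇒prime∤m^e e pp p∤m p∣m^e

prime^e∣m*n⇒prime^e∣n : ∀ {p m} e n → Prime p → ¬ p ∣ m → p ^ e ∣ m * n → p ^ e ∣ n
prime^e∣m*n⇒prime^e∣n zero n _ _ _ = 1∣ n
prime^e∣m*n⇒prime^e∣n {p} {m} (suc e) n pp p∤m p^e+1∣mn
  with euclidsLemma m n pp (∣-trans (m∣m*n (p ^ e)) p^e+1∣mn)
... | inj₁ p∣m = contradiction p∣m p∤m
... | inj₂ (divides n′ refl) =
  subst (p ^ suc e ∣_) (*-comm p n′) (*-monoʳ-∣ p p^e∣n′)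
  where
  instance _ = prime⇒nonZero pp
  regroup : ∀ m n′ p → m * (n′ * p) ≡ p * (m * n′)
  regroup = solve-∀
  p^e∣n′ : p ^ e ∣ n′
  p^e∣n′ = prime^e∣m*n⇒prime^e∣n e n′ pp p∤m
             (*-cancelˡ-∣ p (subst (p * p ^ e ∣_) (regroup m n′ p) p^e+1∣mn))

product^e∣ : ∀ {e N} ps → All Prime ps → Unique ps → All (λ q → q ^ e ∣ N) ps → product ps ^ e ∣ N
product^e∣ {e} {N} [] _ _ _ = subst (_∣ N) (sym (^-zeroˡ e)) (1∣ N)
product^e∣ {e} (q ∷ ps) (pq ∷ pps) (q∉ps ∷ uq) (q^e∣N ∷ ps^e∣N)
  with product^e∣ {e} ps pps uq ps^e∣N
... | divides w refl = begin
  (q * P) ^ e    ≡⟨ [m*n]^o≡m^o*n^o q P e ⟩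
  q ^ e * P ^ e  ∣⟨ *-monoˡ-∣ (P ^ e) q^e∣w ⟩
  w * P ^ e      ∎
  where
  open ∣-Reasoning
  P = product ps
  q∤P : ¬ q ∣ P
  q∤P q∣P = All.lookup q∉ps (prime∣product⇒∈ ps pq pps q∣P) refl
  q^e∣w : q ^ e ∣ w
  q^e∣w = prime^e∣m*n⇒prime^e∣n e w pq (prime∤m⇒prime∤m^e e pq q∤P)
            (subst (q ^ e ∣_) (*-comm w (P ^ e)) q^e∣N)

-- Legendre sums

-- ∑_{i=1}^{f} ⌊n/cⁱ⌋: for prime c and cᶠ > n, Legendre's formula for the c-adic valuation of n!.
legendre : (c : ℕ) .{{_ : NonZero c}} → ℕ → ℕ → ℕ
legendre c zero    n = 0
legendre c (suc f) n = n / c + legendre c f (n / c)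

c^t*t!∣[c*t]! : ∀ c .{{_ : NonZero c}} t → c ^ t * t ! ∣ (c * t) !
c^t*t!∣[c*t]! c zero = ∣-reflexive (cong _! (sym (*-zeroʳ c)))
c^t*t!∣[c*t]! c@(suc c-1) (suc t) = begin
  c ^ suc t * suc t !                ≡⟨ regroup c (c ^ t) (t !) t ⟩
  c * suc t * (c ^ t * t !)          ∣⟨ *-monoʳ-∣ (c * suc t) (∣-trans (c^t*t!∣[c*t]! c t) (m≤n⇒m!∣n! c*t≤)) ⟩
  c * suc t * (t + c-1 * suc t) !    ≡⟨⟩
  (c * suc t) !                      ∎
  where
  open ∣-Reasoning
  regroup : ∀ c x y t → c * x * (suc t * y) ≡ c * suc t * (x * y)
  regroup = solve-∀
  c*t≤ : c * t ≤ t + c-1 * suc t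
  c*t≤ = +-monoʳ-≤ t (*-monoʳ-≤ c-1 (n≤1+n t))

c^legendre∣n! : ∀ c .{{_ : NonZero c}} f n → c ^ legendre c f n ∣ n !
c^legendre∣n! c zero    n = 1∣ (n !)
c^legendre∣n! c (suc f) n = begin
  c ^ (t + legendre c f t)    ≡⟨ ^-distribˡ-+-* c t (legendre c f t) ⟩
  c ^ t * c ^ legendre c f t  ∣⟨ *-monoʳ-∣ (c ^ t) (c^legendre∣n! c f t) ⟩
  c ^ t * t !                 ∣⟨ c^t*t!∣[c*t]! c t ⟩
  (c * t) !                   ∣⟨ m≤n⇒m!∣n! (subst (_≤ n) (*-comm t c) (m/n*n≤m n c)) ⟩
  n !                         ∎
  where
  open ∣-Reasoning
  t = n / c

legendre-monoʳ-≤ : ∀ c .{{_ : NonZero c}} f {m n} → m ≤ n → legendre c f m ≤ legendre c f n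
legendre-monoʳ-≤ c zero    m≤n = z≤n
legendre-monoʳ-≤ c (suc f) m≤n =
  +-mono-≤ m/c≤n/c (legendre-monoʳ-≤ c f m/c≤n/c)
  where m/c≤n/c = /-monoˡ-≤ c m≤n

legendre-monoˡ-≥ : ∀ {p q} .{{_ : NonZero p}} .{{_ : NonZero q}} f n →
                   q ≤ p → legendre p f n ≤ legendre q f n
legendre-monoˡ-≥ {p} {q} zero    n q≤p = z≤n
legendre-monoˡ-≥ {p} {q} (suc f) n q≤p = +-mono-≤ n/p≤n/q (begin
  legendre p f (n / p) ≤⟨ legendre-monoˡ-≥ f (n / p) q≤p ⟩
  legendre q f (n / p) ≤⟨ legendre-monoʳ-≤ q f n/p≤n/q ⟩
  legendre q f (n / q) ∎)
  where
  open ≤-Reasoning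
  n/p≤n/q = /-monoʳ-≤ n q≤p

-- (p-1)·legendre p f n = n - (base-p digit sum of n), and each of the D digits of n is at most p-1.
n≤[p∸1]*[legendre+D] : ∀ p .{{_ : NonZero p}} {f D} n → D ≤ f → n < p ^ D →
                       n ≤ (p ∸ 1) * (legendre p f n + D)
n≤[p∸1]*[legendre+D] p {D = zero} zero _ _ = z≤n
n≤[p∸1]*[legendre+D] p@(suc p-1) {suc f} {suc D} n (s≤s D≤f) n<p^D = begin
  n                               ≡⟨ m≡m%n+[m/n]*n n p ⟩
  n % p + t * p                   ≤⟨ +-monoˡ-≤ (t * p) (s≤s⁻¹ (m%n<n n p)) ⟩
  p-1 + t * p                     ≡⟨ expand p-1 t ⟩
  p-1 + t + p-1 * t               ≤⟨ +-monoˡ-≤ (p-1 * t) (+-monoʳ-≤ p-1 IH) ⟩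
  p-1 + p-1 * (L + D) + p-1 * t   ≡⟨ collect p-1 L D t ⟩
  p-1 * (t + L + suc D)           ∎
  where
  open ≤-Reasoning
  t = n / p
  L = legendre p f t
  IH : t ≤ p-1 * (L + D)
  IH = n≤[p∸1]*[legendre+D] p t D≤f (m<n*o⇒m/o<n (subst (n <_) (*-comm p (p ^ D)) n<p^D))
  expand : ∀ a t → a + t * suc a ≡ a + t + a * t
  expand = solve-∀
  collect : ∀ a L D t → a + a * (L + D) + a * t ≡ a * (t + L + suc D)
  collect = solve-∀
n≤[p∸1]*[legendre+D] p {D = zero} (suc n) _ (s≤s ())

legendre-suc-p* : ∀ p .{{_ : NonZero p}} f x → legendre p (suc f) (p * x) ≡ x + legendre p f x
legendre-suc-p* p f x = cong (λ y → y + legendre p f y) (trans (cong (_/ p) (*-comm p x)) (m*n/n≡m x p))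

-- Trailing zeros in base p do not increase the digit sum.
p^j*m≤[p∸1]*[legendre+D] : ∀ p .{{_ : NonZero p}} {f D} j m → j + D ≤ f → m < p ^ D →
                            p ^ j * m ≤ (p ∸ 1) * (legendre p f (p ^ j * m) + D)
p^j*m≤[p∸1]*[legendre+D] p zero m D≤f m<p^D rewrite *-identityˡ m =
  n≤[p∸1]*[legendre+D] p m D≤f m<p^D
p^j*m≤[p∸1]*[legendre+D] p@(suc p-1) {suc f} {D} (suc j) m (s≤s j+D≤f) m<p^D = begin
  p * p ^ j * m                      ≡⟨ *-assoc p (p ^ j) m ⟩
  p * x                              ≡⟨⟩
  x + p-1 * x                        ≤⟨ +-monoˡ-≤ (p-1 * x) IH ⟩
  p-1 * (legendre p f x + D) + p-1 * x  ≡⟨ collect p-1 (legendre p f x) D x ⟩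
  p-1 * ((x + legendre p f x) + D)   ≡⟨ cong (λ l → p-1 * (l + D)) (legendre-suc-p* p f x) ⟨
  p-1 * (legendre p (suc f) (p * x) + D) ≡⟨ cong (λ y → p-1 * (legendre p (suc f) y + D)) (*-assoc p (p ^ j) m) ⟨
  p-1 * (legendre p (suc f) (p * p ^ j * m) + D) ∎
  where
  open ≤-Reasoning
  x = p ^ j * m
  IH : x ≤ p-1 * (legendre p f x + D)
  IH = p^j*m≤[p∸1]*[legendre+D] p j m j+D≤f m<p^D
  collect : ∀ a L D x → a * (L + D) + a * x ≡ a * (x + L + D)
  collect = solve-∀

-- Products of distinct primes

product<^length : ∀ {p} xs → All NonZero xs → All (_≤ p) xs → Any (_< p) xs →
                  product xs < p ^ length xs
product<^length {p} (x ∷ xs) (_ ∷ xs≢0) (_ ∷ xs≤p) (here x<p) = begin-strict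
  x * product xs    ≤⟨ *-monoʳ-≤ x (product≤^length xs xs≤p) ⟩
  x * p ^ length xs <⟨ *-monoˡ-< (p ^ length xs) {{m^n≢0 p (length xs) {{>-nonZero (≤-<-trans z≤n x<p)}}}} x<p ⟩
  p * p ^ length xs ∎
  where
  open ≤-Reasoning
  product≤^length : ∀ ys → All (_≤ p) ys → product ys ≤ p ^ length ys
  product≤^length []       []           = ≤-refl
  product≤^length (y ∷ ys) (y≤p ∷ ys≤p) = *-mono-≤ y≤p (product≤^length ys ys≤p)
product<^length {p} (x ∷ xs) (x≢0 ∷ xs≢0) (x≤p ∷ xs≤p) (there xs<) = begin-strict
  x * product xs    <⟨ *-monoʳ-< x {{x≢0}} (product<^length xs xs≢0 xs≤p xs<) ⟩
  x * p ^ length xs ≤⟨ *-monoˡ-≤ (p ^ length xs) x≤p ⟩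
  p * p ^ length xs ∎
  where open ≤-Reasoning

unique∧all≤⇒any< : ∀ {p} xs → Unique xs → All (_≤ p) xs → 2 ≤ length xs → Any (_< p) xs
unique∧all≤⇒any< (_ ∷ []) _ _ (s≤s ())
unique∧all≤⇒any< {p} (x ∷ y ∷ _) ((x≢y ∷ _) ∷ _) (x≤p ∷ y≤p ∷ _) _ with x ≟ p
... | no  x≢p  = here (≤∧≢⇒< x≤p x≢p)
... | yes refl = there (here (≤∧≢⇒< y≤p (x≢y ∘ sym)))

module _ {b : ℕ} .{{_ : NonZero b}} {q : ℕ} (pq : Prime q) (q∣b : q ∣ b) where

  private
    primeFactor? : ℕ → Bool
    primeFactor? d = isYes (prime? d) ∧ isYes (d ∣? b)

  ≤largestPrimeFactor : q ≤ largestPrimeFactor b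
  ≤largestPrimeFactor = maxSat-≥ primeFactor? b
    (Equivalence.from T-∧ (fromWitness {a? = prime? q} pq , fromWitness {a? = q ∣? b} q∣b)) (∣⇒≤ q∣b)

  largestPrimeFactor-prime∣ : Prime (largestPrimeFactor b) × largestPrimeFactor b ∣ b
  largestPrimeFactor-prime∣ with maxSat≡0⊎sat primeFactor? b
  ... | inj₁ p≡0 = contradiction (subst (q ≤_) p≡0 ≤largestPrimeFactor)
                                 (<⇒≱ (>-nonZero⁻¹ q {{prime⇒nonZero pq}}))
  ... | inj₂ sat = Product.map (toWitness {a? = prime? p}) (toWitness {a? = p ∣? b})
                                    (Equivalence.to (T-∧ {isYes (prime? p)}) sat)
    where p = largestPrimeFactor b

largestPrimeFactor-product : ∀ {ps} → All Prime ps → 1 ≤ length ps →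
                             let p = largestPrimeFactor (product ps) in
                             Prime p × p ∈ ps × All (_≤ p) ps
largestPrimeFactor-product {q ∷ qs} primes _ = p-prime , p∈ps , All.tabulate ≤p
  where
  instance _ = productOfPrimes≢0 primes
  ps = q ∷ qs
  p-prime∣ = largestPrimeFactor-prime∣ (All.head primes) (∈⇒∣product {ns = ps} (here refl))
  p-prime = proj₁ p-prime∣
  p∈ps = prime∣product⇒∈ ps p-prime primes (proj₂ p-prime∣)
  ≤p : ∀ {x} → x ∈ ps → x ≤ largestPrimeFactor (product ps)
  ≤p x∈ps = ≤largestPrimeFactor (All.lookup primes x∈ps) (∈⇒∣product x∈ps)

-- Rational bounds

toℚᵘ-ℕtoℚ : ∀ n → ℚ.toℚᵘ (ℕtoℚ n) ≡ mkℚᵘ (+ n) 0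
toℚᵘ-ℕtoℚ n = cong ℚ.toℚᵘ (ℚP.normalize-coprime (Coprime.sym (Coprime.1-coprimeTo n)))

ℕtoℚ-+ : ∀ m n → ℕtoℚ (m + n) ≡ ℕtoℚ m ℚ.+ ℕtoℚ n
ℕtoℚ-+ m n = ℚP.toℚᵘ-injective (ℚᵘ.≃-trans ≃-toℚᵘ (ℚᵘ.≃-sym (ℚP.toℚᵘ-homo-+ (ℕtoℚ m) (ℕtoℚ n))))
  where
  ≃-toℚᵘ : ℚ.toℚᵘ (ℕtoℚ (m + n)) ℚᵘ.≃ ℚ.toℚᵘ (ℕtoℚ m) ℚᵘ.+ ℚ.toℚᵘ (ℕtoℚ n)
  ≃-toℚᵘ rewrite toℚᵘ-ℕtoℚ m | toℚᵘ-ℕtoℚ n | toℚᵘ-ℕtoℚ (m + n) | ℤP.pos-+ m n = *≡* (cross (+ m) (+ n))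
    where
    cross : ∀ a b → (a ℤ.+ b) ℤ.* + 1 ≡ (a ℤ.* + 1 ℤ.+ b ℤ.* + 1) ℤ.* + 1
    cross = ℤ-solve-∀

ℕtoℚ-* : ∀ m n → ℕtoℚ (m * n) ≡ ℕtoℚ m ℚ.* ℕtoℚ n
ℕtoℚ-* m n = ℚP.toℚᵘ-injective (ℚᵘ.≃-trans ≃-toℚᵘ (ℚᵘ.≃-sym (ℚP.toℚᵘ-homo-* (ℕtoℚ m) (ℕtoℚ n))))
  where
  ≃-toℚᵘ : ℚ.toℚᵘ (ℕtoℚ (m * n)) ℚᵘ.≃ ℚ.toℚᵘ (ℕtoℚ m) ℚᵘ.* ℚ.toℚᵘ (ℕtoℚ n)
  ≃-toℚᵘ rewrite toℚᵘ-ℕtoℚ m | toℚᵘ-ℕtoℚ n | toℚᵘ-ℕtoℚ (m * n) | ℤP.pos-* m n = *≡* refl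

ℕtoℚ-mono-≤ : ∀ {m n} → m ≤ n → ℕtoℚ m ℚ.≤ ℕtoℚ n
ℕtoℚ-mono-≤ {m} {n} m≤n = ℚP.toℚᵘ-cancel-≤ ≤-toℚᵘ
  where
  ≤-toℚᵘ : ℚ.toℚᵘ (ℕtoℚ m) ℚᵘ.≤ ℚ.toℚᵘ (ℕtoℚ n)
  ≤-toℚᵘ rewrite toℚᵘ-ℕtoℚ m | toℚᵘ-ℕtoℚ n = *≤* (ℤP.*-monoʳ-≤-nonNeg (+ 1) (ℤ.+≤+ m≤n))

1/[1+q]*[1+q]≡1 : ∀ q → + 1 ℚ./ suc q ℚ.* ℕtoℚ (suc q) ≡ ℚ.1ℚ
1/[1+q]*[1+q]≡1 q = trans (cong₂ ℚ._*_ (ℚP.normalize-coprime (Coprime.1-coprimeTo (suc q))) (ℚP.normalize-coprime 1+q⊥1))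
                          (ℚP.*-inverseˡ (mkℚ (+ suc q) 0 1+q⊥1))
  where 1+q⊥1 = Coprime.sym (Coprime.1-coprimeTo (suc q))

1/[1+q]*n≤m : ∀ q {n m} → n ≤ suc q * m → + 1 ℚ./ suc q ℚ.* ℕtoℚ n ℚ.≤ ℕtoℚ m
1/[1+q]*n≤m q {n} {m} n≤[1+q]m = begin
  c ℚ.* ℕtoℚ n                   ≤⟨ ℚP.*-monoˡ-≤-nonNeg c (ℕtoℚ-mono-≤ n≤[1+q]m) ⟩
  c ℚ.* ℕtoℚ (suc q * m)         ≡⟨ cong (c ℚ.*_) (ℕtoℚ-* (suc q) m) ⟩
  c ℚ.* (ℕtoℚ (suc q) ℚ.* ℕtoℚ m) ≡⟨ ℚP.*-assoc c (ℕtoℚ (suc q)) (ℕtoℚ m) ⟨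
  (c ℚ.* ℕtoℚ (suc q)) ℚ.* ℕtoℚ m ≡⟨ cong (ℚ._* ℕtoℚ m) (1/[1+q]*[1+q]≡1 q) ⟩
  ℚ.1ℚ ℚ.* ℕtoℚ m                 ≡⟨ ℚP.*-identityˡ (ℕtoℚ m) ⟩
  ℕtoℚ m                          ∎
  where
  open ℚP.≤-Reasoning
  c = + 1 ℚ./ suc q
  instance _ = ℚP.normalize-nonNeg 1 (suc q)

x≤z+K⇒x-z≤K : ∀ {x} z K → x ℚ.≤ ℕtoℚ (z + K) → x ℚ.- ℕtoℚ z ℚ.≤ ℕtoℚ K
x≤z+K⇒x-z≤K {x} z K x≤z+K = begin
  x ℚ.- ℕtoℚ z                       ≤⟨ ℚP.+-monoˡ-≤ (ℚ.- ℕtoℚ z) x≤z+K ⟩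
  ℕtoℚ (z + K) ℚ.- ℕtoℚ z            ≡⟨ cong (ℚ._- ℕtoℚ z) (ℕtoℚ-+ z K) ⟩
  (ℕtoℚ z ℚ.+ ℕtoℚ K) ℚ.- ℕtoℚ z     ≡⟨ cancel (ℕtoℚ z) (ℕtoℚ K) ⟩
  ℕtoℚ K                             ∎
  where
  open ℚP.≤-Reasoning
  open ℚ-Solver
  cancel : ∀ a b → (a ℚ.+ b) ℚ.- a ≡ b
  cancel = solve 2 (λ a b → (a :+ b) :- a := b) refl

x≤m⇒⌊x⌋≤m : ∀ x m → x ℚ.≤ ℕtoℚ m → ℚ.floor x ℤ.≤ + m
x≤m⇒⌊x⌋≤m x@(mkℚ i d-1 _) m x≤m =
  ℤP.*-cancelʳ-≤-pos (i ℤ./ d) (+ m) d (ℤP.≤-trans (ℤ.[n/d]*d≤n i d) i≤m*d)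
  where
  d = + suc d-1
  i≤m*d : i ℤ.≤ + m ℤ.* d
  i≤m*d = subst (ℤ._≤ + m ℤ.* d) (ℤP.*-identityʳ i)
            (ℚP.drop-*≤* (subst (x ℚ.≤_) (ℚP.normalize-coprime (Coprime.sym (Coprime.1-coprimeTo m))) x≤m))

x≤z+K⇒⌊x⌋-z≤K : ∀ x z K → x ℚ.≤ ℕtoℚ (z + K) → ℚ.floor x ℤ.- + z ℤ.≤ + K
x≤z+K⇒⌊x⌋-z≤K x z K x≤z+K = begin
  ℚ.floor x ℤ.- + z     ≤⟨ ℤP.+-monoˡ-≤ (ℤ.- + z) (x≤m⇒⌊x⌋≤m x (z + K) x≤z+K) ⟩
  + (z + K) ℤ.- + z     ≡⟨ cong (ℤ._- + z) (ℤP.pos-+ z K) ⟩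
  (+ z ℤ.+ + K) ℤ.- + z ≡⟨ cancel (+ z) (+ K) ⟩
  + K                   ∎
  where
  open ℤP.≤-Reasoning
  cancel : ∀ a b → (a ℤ.+ b) ℤ.- a ≡ b
  cancel = ℤ-solve-∀

ϑ*n≤m : ∀ b {n m} → 2 ≤ largestPrimeFactor b → n ≤ (largestPrimeFactor b ∸ 1) * m →
        ϑ b ℚ.* ℕtoℚ n ℚ.≤ ℕtoℚ m
ϑ*n≤m b 2≤p n≤[p∸1]m with largestPrimeFactor b | 2≤p
... | suc (suc q) | _       = 1/[1+q]*n≤m q n≤[p∸1]m
... | suc zero    | s≤s ()
... | zero        | ()

η≤digits : ∀ {b k K} → 2 ≤ b → α b k ℤ.≤ + K → η b k ≤ digits b K
η≤digits {b} {k} {K} 2≤b α≤K with α b k | α≤K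
... | + a      | ℤ.+≤+ a≤K = digits-≤ 2≤b (≤-<-trans a≤K (n<b^digits 2≤b K))
... | ℤ.-[1+ _ ] | _        = z≤n

-- Size of a product of distinct primes

composite≤prime⇒< : ∀ {n p} → Composite n → Prime p → n ≤ p → n < p
composite≤prime⇒< cn pp n≤p with m≤n⇒m<n∨m≡n n≤p
... | inj₁ n<p  = n<p
... | inj₂ refl = contradiction pp (composite⇒¬prime cn)

risingFactorial : ℕ → ℕ → ℕ
risingFactorial a zero    = 1
risingFactorial a (suc t) = a * risingFactorial (suc a) t

risingFactorial-suc : ∀ a t → risingFactorial a (suc t) ≡ risingFactorial a t * (a + t)
risingFactorial-suc a zero    = trans (*-comm a 1) (cong (1 *_) (sym (+-identityʳ a)))
risingFactorial-suc a (suc t) = begin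
  a * risingFactorial (suc a) (suc t)         ≡⟨ cong (a *_) (risingFactorial-suc (suc a) t) ⟩
  a * (risingFactorial (suc a) t * (suc a + t)) ≡⟨ *-assoc a (risingFactorial (suc a) t) (suc a + t) ⟨
  a * risingFactorial (suc a) t * (suc a + t) ≡⟨ cong (a * risingFactorial (suc a) t *_) (+-suc a t) ⟨
  a * risingFactorial (suc a) t * (a + suc t) ∎
  where open ≡-Reasoning

risingFactorial≤product : ∀ {a} xs → AllPairs _<_ xs → All (a ≤_) xs → risingFactorial a (length xs) ≤ product xs
risingFactorial≤product []       []           []           = ≤-refl
risingFactorial≤product (x ∷ xs) (x<xs ∷ ↗xs) (a≤x ∷ _) =
  *-mono-≤ a≤x (risingFactorial≤product xs ↗xs (All.map (≤-trans (s≤s a≤x)) x<xs))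

-- The i-th smallest of distinct primes is at least the i-th of 2, 3, 5, 7, 8, 9, 10, …
primeProductBound : ℕ → ℕ
primeProductBound 0 = 1
primeProductBound 1 = 2
primeProductBound 2 = 6
primeProductBound 3 = 30
primeProductBound (suc (suc (suc (suc t)))) = 210 * risingFactorial 8 t

primeProductBound≤product : ∀ xs → AllPairs _<_ xs → All Prime xs → primeProductBound (length xs) ≤ product xs
primeProductBound≤product [] _ _ = ≤-refl
primeProductBound≤product (x₁ ∷ []) _ (p₁ ∷ _) = *-monoˡ-≤ 1 (prime≥2 p₁)
primeProductBound≤product (x₁ ∷ x₂ ∷ []) ((x₁<x₂ ∷ _) ∷ _) (p₁ ∷ _) =
  *-mono-≤ (prime≥2 p₁) (*-monoˡ-≤ 1 (≤-trans (s≤s (prime≥2 p₁)) x₁<x₂))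
primeProductBound≤product (x₁ ∷ x₂ ∷ x₃ ∷ []) ((x₁<x₂ ∷ _) ∷ (x₂<x₃ ∷ _) ∷ _) (p₁ ∷ _ ∷ p₃ ∷ _) =
  *-mono-≤ 2≤x₁ (*-mono-≤ 3≤x₂ (*-monoˡ-≤ 1 5≤x₃))
  where
  2≤x₁ = prime≥2 p₁
  3≤x₂ = ≤-trans (s≤s 2≤x₁) x₁<x₂
  5≤x₃ = composite≤prime⇒< composite[4] p₃ (≤-trans (s≤s 3≤x₂) x₂<x₃)
primeProductBound≤product (x₁ ∷ x₂ ∷ x₃ ∷ x₄ ∷ xs)
  ((x₁<x₂ ∷ _) ∷ (x₂<x₃ ∷ _) ∷ (x₃<x₄ ∷ _) ∷ (x₄<xs ∷ ↗xs)) (p₁ ∷ _ ∷ p₃ ∷ p₄ ∷ _) = begin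
  210 * risingFactorial 8 (length xs)                 ≡⟨ factor (risingFactorial 8 (length xs)) ⟩
  2 * (3 * (5 * (7 * risingFactorial 8 (length xs)))) ≤⟨ *-mono-≤ 2≤x₁ (*-mono-≤ 3≤x₂ (*-mono-≤ 5≤x₃ (*-mono-≤ 7≤x₄ 8⋯≤xs))) ⟩
  x₁ * (x₂ * (x₃ * (x₄ * product xs)))                ∎
  where
  open ≤-Reasoning
  factor : ∀ r → 210 * r ≡ 2 * (3 * (5 * (7 * r)))
  factor = solve-∀
  2≤x₁ = prime≥2 p₁
  3≤x₂ = ≤-trans (s≤s 2≤x₁) x₁<x₂
  5≤x₃ = composite≤prime⇒< composite[4] p₃ (≤-trans (s≤s 3≤x₂) x₂<x₃)
  7≤x₄ = composite≤prime⇒< composite[6] p₄ (≤-trans (s≤s 5≤x₃) x₃<x₄)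
  8⋯≤xs = risingFactorial≤product xs ↗xs (All.map (≤-trans (s≤s 7≤x₄)) x₄<xs)

primeProductBound≤product-distinct : ∀ ps → All Prime ps → Unique ps → primeProductBound (length ps) ≤ product ps
primeProductBound≤product-distinct ps primes distinct =
  subst₂ (λ l P → primeProductBound l ≤ P) (↭-length sorted↭ps) (product-↭ sorted↭ps)
    (primeProductBound≤product (sort ps) sorted-strict (All-resp-↭ (↭-sym sorted↭ps) primes))
  where
  sorted↭ps = sort-↭ ps
  sorted-distinct : Unique (sort ps)
  sorted-distinct = Unique-resp-↭ (setoid ℕ) (↭⇒↭ₛ (↭-sym sorted↭ps)) distinct
  sorted-strict : AllPairs _<_ (sort ps)
  sorted-strict = AllPairs.zipWith (uncurry ≤∧≢⇒<) (Linked⇒AllPairs ≤-trans (sort-↗ ps) , sorted-distinct)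

[5+t]^5≤[4+t]^5*[9+t] : ∀ t → (5 + t) ^ 5 ≤ (4 + t) ^ 5 * (9 + t)
[5+t]^5≤[4+t]^5*[9+t] t = *-cancelˡ-≤ (4 ^ 5) (begin
  4 ^ 5 * (5 + t) ^ 5             ≡⟨ [m*n]^o≡m^o*n^o 4 (5 + t) 5 ⟨
  (4 * (5 + t)) ^ 5               ≤⟨ ^-monoˡ-≤ 5 (≤-trans (m≤m+n (4 * (5 + t)) t) (≤-reflexive (shift t))) ⟩
  (5 * (4 + t)) ^ 5               ≡⟨ [m*n]^o≡m^o*n^o 5 (4 + t) 5 ⟩
  5 ^ 5 * (4 + t) ^ 5             ≤⟨ *-monoˡ-≤ ((4 + t) ^ 5) 5^5≤4^5*[9+t] ⟩
  4 ^ 5 * (9 + t) * (4 + t) ^ 5   ≡⟨ swap (4 ^ 5) (9 + t) ((4 + t) ^ 5) ⟩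
  4 ^ 5 * ((4 + t) ^ 5 * (9 + t)) ∎)
  where
  open ≤-Reasoning
  5^5≤4^5*[9+t] = ≤-trans (≤ᵇ⇒≤ 3125 9216 _) (*-monoʳ-≤ (4 ^ 5) (m≤m+n 9 t))
  shift : ∀ t → 4 * (5 + t) + t ≡ 5 * (4 + t)
  shift = solve-∀
  swap : ∀ a b c → a * b * c ≡ a * (c * b)
  swap = solve-∀

[4+t]^5≤primeProductBound[5+t] : ∀ t → (4 + t) ^ 5 ≤ primeProductBound (5 + t)
[4+t]^5≤primeProductBound[5+t] zero    = ≤ᵇ⇒≤ 1024 1680 _
[4+t]^5≤primeProductBound[5+t] (suc t) = begin
  (5 + t) ^ 5                    ≤⟨ [5+t]^5≤[4+t]^5*[9+t] t ⟩
  (4 + t) ^ 5 * (9 + t)          ≤⟨ *-monoˡ-≤ (9 + t) ([4+t]^5≤primeProductBound[5+t] t) ⟩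
  210 * risingFactorial 8 (suc t) * (9 + t) ≡⟨ *-assoc 210 (risingFactorial 8 (suc t)) (9 + t) ⟩
  210 * (risingFactorial 8 (suc t) * (8 + suc t)) ≡⟨ cong (210 *_) (risingFactorial-suc 8 (suc t)) ⟨
  210 * risingFactorial 8 (suc (suc t))   ∎
  where open ≤-Reasoning

m^5≤n⇒m^100≤n^21 : ∀ m {n} .{{_ : NonZero m}} → m ^ 5 ≤ n → m ^ 100 ≤ n ^ 21
m^5≤n⇒m^100≤n^21 m {n} m^5≤n = begin
  m ^ 100        ≤⟨ ^-monoʳ-≤ m (≤ᵇ⇒≤ 100 105 _) ⟩
  m ^ (5 * 21)   ≡⟨ ^-*-assoc m 5 21 ⟨
  (m ^ 5) ^ 21   ≤⟨ ^-monoˡ-≤ 21 m^5≤n ⟩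
  n ^ 21         ∎
  where open ≤-Reasoning

n^100≤primeProductBound[1+n]^21 : ∀ n → n ^ 100 ≤ primeProductBound (suc n) ^ 21
n^100≤primeProductBound[1+n]^21 0 = z≤n
n^100≤primeProductBound[1+n]^21 1 = ≤ᵇ⇒≤ 1 (6 ^ 21) _
n^100≤primeProductBound[1+n]^21 2 = ≤ᵇ⇒≤ (2 ^ 100) (30 ^ 21) _
n^100≤primeProductBound[1+n]^21 3 = ≤ᵇ⇒≤ (3 ^ 100) (210 ^ 21) _
n^100≤primeProductBound[1+n]^21 (suc (suc (suc (suc t)))) =
  m^5≤n⇒m^100≤n^21 (suc (suc (suc (suc t)))) ([4+t]^5≤primeProductBound[5+t] t)

b^[100*digits]≤k^100*b^121 : ∀ {b} k u → 2 ≤ b → 1 ≤ k * u → u ^ 100 ≤ b ^ 21 →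
                              b ^ (100 * digits b (k * u)) ≤ k ^ 100 * b ^ 121
b^[100*digits]≤k^100*b^121 {b} k u 2≤b 1≤ku u^100≤b^21 = begin
  b ^ (100 * d)                     ≡⟨ cong (b ^_) (*-comm 100 d) ⟩
  b ^ (d * 100)                     ≡⟨ ^-*-assoc b d 100 ⟨
  (b ^ d) ^ 100                     ≤⟨ ^-monoˡ-≤ 100 (b^digits≤b*n 2≤b 1≤ku) ⟩
  (b * (k * u)) ^ 100               ≡⟨ [m*n]^o≡m^o*n^o b (k * u) 100 ⟩
  b ^ 100 * (k * u) ^ 100           ≡⟨ cong (b ^ 100 *_) ([m*n]^o≡m^o*n^o k u 100) ⟩
  b ^ 100 * (k ^ 100 * u ^ 100)     ≤⟨ *-monoʳ-≤ (b ^ 100) (*-monoʳ-≤ (k ^ 100) u^100≤b^21) ⟩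
  b ^ 100 * (k ^ 100 * b ^ 21)      ≡⟨ regroup (b ^ 100) (k ^ 100) (b ^ 21) ⟩
  k ^ 100 * (b ^ 100 * b ^ 21)      ≡⟨ cong (k ^ 100 *_) (^-distribˡ-+-* b 100 21) ⟨
  k ^ 100 * b ^ 121                 ∎
  where
  open ≤-Reasoning
  d = digits b (k * u)
  regroup : ∀ x y z → x * (y * z) ≡ y * (x * z)
  regroup = solve-∀

module _ {ps : List ℕ} (primes : All Prime ps) (distinct : Unique ps) (2≤s : 2 ≤ length ps) where

  private
    b = product ps
    s = length ps
    p = largestPrimeFactor b
    1≤s = ≤-trans (s≤s z≤n) 2≤s
    p-prime = proj₁ (largestPrimeFactor-product primes 1≤s)
    p∈ps    = proj₁ (proj₂ (largestPrimeFactor-product primes 1≤s))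
    ps≤p    = proj₂ (proj₂ (largestPrimeFactor-product primes 1≤s))
    instance
      p≢0 = prime⇒nonZero p-prime
      b≢0 = productOfPrimes≢0 primes

  2≤product : 2 ≤ b
  2≤product = ≤-trans (prime≥2 p-prime) (∣⇒≤ (∈⇒∣product p∈ps))

  b≡b/p*p : b ≡ b / p * p
  b≡b/p*p = sym (m/n*n≡m (∈⇒∣product p∈ps))

  b/p<p^[s∸1] : b / p < p ^ (s ∸ 1)
  b/p<p^[s∸1] = *-cancelʳ-< p (b / p) (p ^ (s ∸ 1)) (begin-strict
    b / p * p         ≡⟨ b≡b/p*p ⟨
    b                 <⟨ product<^length ps (All.map prime⇒nonZero primes) ps≤p some<p ⟩
    p ^ s             ≡⟨ cong (p ^_) (m+[n∸m]≡n 1≤s) ⟨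
    p * p ^ (s ∸ 1)   ≡⟨ *-comm p (p ^ (s ∸ 1)) ⟩
    p ^ (s ∸ 1) * p   ∎)
    where
    open ≤-Reasoning
    some<p = unique∧all≤⇒any< ps distinct ps≤p 2≤s

  b^legendre∣n! : ∀ f n → b ^ legendre p f n ∣ n !
  b^legendre∣n! f n = product^e∣ {legendre p f n} ps primes distinct (All.tabulate q^legendre∣n!)
    where
    q^legendre∣n! : ∀ {q} → q ∈ ps → q ^ legendre p f n ∣ n !
    q^legendre∣n! {q} q∈ps =
      ∣-trans (m^i∣m^j q (legendre-monoˡ-≥ f n (All.lookup ps≤p q∈ps))) (c^legendre∣n! q f n)
      where instance _ = prime⇒nonZero (All.lookup primes q∈ps)

  b^k≤[p∸1]*[Z+k*[s∸1]] : ∀ k → 1 ≤ k → b ^ k ≤ (p ∸ 1) * (Z b (b ^ k) + k * (s ∸ 1))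
  b^k≤[p∸1]*[Z+k*[s∸1]] k 1≤k = begin
    b ^ k
      ≡⟨ b^k≡p^k*m^k ⟩
    p ^ k * m ^ k
      ≤⟨ p^j*m≤[p∸1]*[legendre+D] p k (m ^ k) ≤-refl m^k<p^D ⟩
    (p ∸ 1) * (legendre p (k + D) (p ^ k * m ^ k) + D)
      ≡⟨ cong (λ n → (p ∸ 1) * (legendre p (k + D) n + D)) b^k≡p^k*m^k ⟨
    (p ∸ 1) * (legendre p (k + D) (b ^ k) + D)
      ≤⟨ *-monoʳ-≤ (p ∸ 1) (+-mono-≤ legendre≤Z (≤-reflexive (*-comm (s ∸ 1) k))) ⟩
    (p ∸ 1) * (Z b (b ^ k) + k * (s ∸ 1))
      ∎
    where
    open ≤-Reasoning
    instance _ = >-nonZero 1≤k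
    m = b / p
    D = (s ∸ 1) * k
    b^k≡p^k*m^k : b ^ k ≡ p ^ k * m ^ k
    b^k≡p^k*m^k = trans (cong (_^ k) b≡b/p*p) (trans ([m*n]^o≡m^o*n^o m p k) (*-comm (m ^ k) (p ^ k)))
    m^k<p^D : m ^ k < p ^ D
    m^k<p^D = subst (m ^ k <_) (^-*-assoc p (s ∸ 1) k) (^-monoˡ-< k b/p<p^[s∸1])
    legendre≤Z : legendre p (k + D) (b ^ k) ≤ Z b (b ^ k)
    legendre≤Z = b^e∣m!⇒e≤Z (b ^ k) 2≤product (b^legendre∣n! (k + D) (b ^ k))

  2≤largestPrimeFactor : 2 ≤ p
  2≤largestPrimeFactor = prime≥2 p-prime

  [s∸1]^100≤b^21 : (s ∸ 1) ^ 100 ≤ b ^ 21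
  [s∸1]^100≤b^21 = ≤-trans (n^100≤primeProductBound[1+n]^21 (s ∸ 1)) (^-monoˡ-≤ 21 (begin
    primeProductBound (suc (s ∸ 1)) ≡⟨ cong primeProductBound (m+[n∸m]≡n 1≤s) ⟩
    primeProductBound s             ≤⟨ primeProductBound≤product-distinct ps primes distinct ⟩
    b                               ∎))
    where open ≤-Reasoning

proposition7 : (b s : ℕ) (ps : List ℕ) → All Prime ps → Unique ps →
               length ps ≡ s → product ps ≡ b → 2 ≤ s →
               (k : ℕ) → 1 ≤ k →
               ((ϑ b ℚ.* ℕtoℚ (b ^ k)) ℚ.- ℕtoℚ (Z b (b ^ k)) ℚ.≤ ℕtoℚ (k * (s ∸ 1)))
               × (η b k ≤ digits b (k * (s ∸ 1)))
               × (b ^ (100 * digits b (k * (s ∸ 1))) ≤ (k ^ 100) * (b ^ 121))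
proposition7 b s ps primes distinct refl refl 2≤s k 1≤k =
  x≤z+K⇒x-z≤K Zb K ϑb^k≤Z+K ,
  η≤digits {b} {k} 2≤b (x≤z+K⇒⌊x⌋-z≤K (ϑ b ℚ.* ℕtoℚ (b ^ k)) Zb K ϑb^k≤Z+K) ,
  b^[100*digits]≤k^100*b^121 k (s ∸ 1) 2≤b 1≤K ([s∸1]^100≤b^21 primes distinct 2≤s)
  where
  K = k * (s ∸ 1)
  Zb = Z b (b ^ k)
  1≤K : 1 ≤ K
  1≤K = *-mono-≤ 1≤k (∸-monoˡ-≤ 1 2≤s)
  2≤b : 2 ≤ b
  2≤b = 2≤product primes distinct 2≤s
  ϑb^k≤Z+K : ϑ b ℚ.* ℕtoℚ (b ^ k) ℚ.≤ ℕtoℚ (Zb + K)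
  ϑb^k≤Z+K = ϑ*n≤m b (2≤largestPrimeFactor primes distinct 2≤s)
                     (b^k≤[p∸1]*[Z+k*[s∸1]] primes distinct 2≤s k 1≤k)
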